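{- Let $m$ be a positive integer and let $\ell=\ell(m)$ be the largest integer with $\ell^{\ell}\le m$. Then for all sufficiently large $m$, for every $m$-tuple of preference lists of $m$ buyers, the number of distinct reachable sets of houses is at most $\binom{2m-\ell+4}{m}$. Equivalently, $f(m)\le \binom{2m-\ell+4}{m}$ for all sufficiently large $m$.
   Context: House allocation setting: $A$ is a set of $m$ buyers and $B$ is an infinite (countable) set of houses. Each buyer $a\in A$ has a preference list, i.e., an ordering of all houses of $B$ into a sequence (first choice, second choice, ...), in which a house placed earlier is preferred. A matching is an injective map $\tau:A\to B$. A matching $\tau$ is Pareto optimal (a POM) if there is no nonempty set $A'\subseteq A$ and matching $\tau'$ that differs from $\tau$ only on $A'$ such that for every $a\in A'$ the house $\tau'(a)$ is placed higher in the preference list of $a$ than $\tau(a)$. For a matching $\tau$ let $s(\tau)=\{\tau(a):a\in A\}$ be the set of houses sold. A set $E\subseteq B$ is reachable if $E=s(\tau)$ for some POM $\tau$. $f(m)$ denotes the maximum, over all $m$-tuples of preference lists of $m$ buyers, of the number of reachable sets. -}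

module Defs where

open import Data.Nat using (ℕ; _<_)
open import Data.Fin using (Fin)
open import Data.Fin.Subset using (Subset; _∈_; _∉_; Nonempty)
open import Data.Product using (Σ; ∃; _×_)
open import Relation.Binary.PropositionalEquality using (_≡_)
open import Relation.Nullary using (¬_)
open import Function.Bundles using (_⇔_)

-- Houses: the countably infinite set B is modelled by ℕ.
-- Buyers: A = Fin m.
House : Set
House = ℕ

-- A preference list is an ordering of ALL houses into a sequence
-- (first choice, second choice, ...): a bijection σ : ℕ → House,
-- σ p = the house at position p (position 0 = first choice).
IsPrefList : (ℕ → House) → Set
IsPrefList σ = (∀ {p q} → σ p ≡ σ q → p ≡ q) × (∀ h → ∃ λ p → σ p ≡ h)

PrefProfile : ℕ → Set
PrefProfile m = Fin m → ℕ → House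

ValidProfile : ∀ {m} → PrefProfile m → Set
ValidProfile {m} P = ∀ (a : Fin m) → IsPrefList (P a)

PlacedHigher : (ℕ → House) → House → House → Set
PlacedHigher σ h h' = ∃ λ p → ∃ λ q → σ p ≡ h × σ q ≡ h' × p < q

IsMatching : ∀ {m} → (Fin m → House) → Set
IsMatching τ = ∀ {a b} → τ a ≡ τ b → a ≡ b

IsPOM : ∀ {m} → PrefProfile m → (Fin m → House) → Set
IsPOM {m} P τ =
  IsMatching τ ×
  ¬ (Σ (Subset m) λ A' → Σ (Fin m → House) λ τ' →
        Nonempty A' × IsMatching τ' ×
        (∀ a → a ∉ A' → τ' a ≡ τ a) ×
        (∀ a → a ∈ A' → PlacedHigher (P a) (τ' a) (τ a)))

Sold : ∀ {m} → (Fin m → House) → House → Set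
Sold {m} τ h = ∃ λ (a : Fin m) → τ a ≡ h

SameSold : ∀ {m} → (Fin m → House) → (Fin m → House) → Set
SameSold τ τ' = ∀ h → Sold τ h ⇔ Sold τ' h

-- Encode a Pareto optimal matching τ by a code.  The buyers are processed in
-- turn; buyer a looks at its choices down to its own house τ a and discovers
-- those not discovered before; the code records how many it discovers.
-- Pareto optimality makes every house a buyer prefers to its own sold (else
-- that buyer alone could switch to it), so the discovered houses are exactly
-- the sold ones; and as fresh houses only accumulate down a preference list,
-- the code determines the sold set.  Each buyer's own house is discovered by
-- the time it is processed and only m houses are sold, so codes are ballot
-- sequences, of which there are Catalan(m) = C(2m, m)/(m + 1).  Since moving
-- from C(2m − i, m) to C(2m − i − 1, m) loses at most a factor 3 while
-- i ≤ m/2, Catalan(m) ≤ C(2m − j, m) once 3^j ≤ m + 1; j = ℓ − 4 suffices.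
module Submission where

open import Defs
open import Data.Nat using (ℕ; _+_; _*_; _∸_; _^_; _≤_; _<_; suc)
open import Data.Nat.Combinatorics using (_C_)
open import Data.Fin using (Fin)
open import Data.Product using (∃; _×_)
open import Relation.Binary.PropositionalEquality using (_≡_)
open import Relation.Nullary using (¬_)
open import Data.Product using (_,_)
open import Data.Nat.Properties using (≤-trans)

-- Lattice paths and ballot numbers.
module BallotNumbers where

  open import Data.Nat
  open import Data.Nat.Properties
  open import Data.Nat.Combinatorics using (_C_; nCk+nC[k+1]≡[n+1]C[k+1]; nCn≡1)
  open import Relation.Binary.PropositionalEquality
  open import Data.Nat.Tactic.RingSolver using (solve-∀)

  paths : ℕ → ℕ → ℕ
  paths zero    b       = 1
  paths (suc a) zero    = 1
  paths (suc a) (suc b) = paths a (suc b) + paths (suc a) b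

  paths≡binomial : ∀ a b → paths a b ≡ (a + b) C a
  paths≡binomial zero    b       = refl
  paths≡binomial (suc a) zero    = begin
    1                     ≡⟨ sym (nCn≡1 (suc a)) ⟩
    suc a C suc a         ≡⟨ cong (_C suc a) (sym (+-identityʳ (suc a))) ⟩
    (suc a + 0) C suc a   ∎
    where open ≡-Reasoning
  paths≡binomial (suc a) (suc b) = begin
    paths a (suc b) + paths (suc a) b          ≡⟨ cong₂ _+_ (paths≡binomial a (suc b)) (paths≡binomial (suc a) b) ⟩
    (a + suc b) C a + (suc a + b) C suc a      ≡⟨ cong (λ n → (a + suc b) C a + n C suc a) (sym (+-suc a b)) ⟩
    (a + suc b) C a + (a + suc b) C suc a      ≡⟨ nCk+nC[k+1]≡[n+1]C[k+1] (a + suc b) a ⟩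
    (suc a + suc b) C suc a                    ∎
    where open ≡-Reasoning

  paths-sym : ∀ a b → paths a b ≡ paths b a
  paths-sym zero    zero    = refl
  paths-sym zero    (suc b) = refl
  paths-sym (suc a) zero    = refl
  paths-sym (suc a) (suc b) = begin
    paths a (suc b) + paths (suc a) b   ≡⟨ cong₂ _+_ (paths-sym a (suc b)) (paths-sym (suc a) b) ⟩
    paths (suc b) a + paths b (suc a)   ≡⟨ +-comm (paths (suc b) a) (paths b (suc a)) ⟩
    paths b (suc a) + paths (suc b) a   ∎
    where open ≡-Reasoning

  paths-one : ∀ a → paths a 1 ≡ suc a
  paths-one zero    = refl
  paths-one (suc a) = trans (cong (_+ 1) (paths-one a)) (+-comm (suc a) 1)

  -- The absorption identity (b+1)·C(a+b+1, a) = (a+b+1)·C(a+b, a), in both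
  -- directions of growth; it controls the ratio of neighbouring coefficients.
  paths-absorptionʳ : ∀ a b → suc b * paths a (suc b) ≡ suc (a + b) * paths a b
  paths-absorptionʳ zero    b       = refl
  paths-absorptionʳ (suc a) zero    = trans (cong (λ x → 1 * (x + 1)) (paths-one a)) (base a)
    where
    base : ∀ a → 1 * (suc a + 1) ≡ suc (suc a + 0) * 1
    base = solve-∀
  paths-absorptionʳ (suc a) (suc b) = begin
    suc (suc b) * (W + (X + Y))                         ≡⟨ expand b W X Y ⟩
    suc (suc b) * W + (suc b * (X + Y) + (X + Y))       ≡⟨ cong₂ (λ u v → u + (v + (X + Y)))
                                                             (paths-absorptionʳ a (suc b)) (paths-absorptionʳ (suc a) b) ⟩
    suc (a + suc b) * X + (suc (suc a + b) * Y + (X + Y)) ≡⟨ collect a b X Y ⟩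
    suc (suc a + suc b) * (X + Y)                       ∎
    where
    open ≡-Reasoning
    X = paths a (suc b)
    Y = paths (suc a) b
    W = paths a (suc (suc b))
    expand : ∀ b W X Y → suc (suc b) * (W + (X + Y)) ≡ suc (suc b) * W + (suc b * (X + Y) + (X + Y))
    expand = solve-∀
    collect : ∀ a b X Y → suc (a + suc b) * X + (suc (suc a + b) * Y + (X + Y)) ≡ suc (suc a + suc b) * (X + Y)
    collect = solve-∀

  paths-absorptionˡ : ∀ a b → suc a * paths (suc a) b ≡ suc (a + b) * paths a b
  paths-absorptionˡ a b = begin
    suc a * paths (suc a) b   ≡⟨ cong (suc a *_) (paths-sym (suc a) b) ⟩
    suc a * paths b (suc a)   ≡⟨ paths-absorptionʳ b a ⟩
    suc (b + a) * paths b a   ≡⟨ cong₂ (λ u v → suc u * v) (+-comm b a) (paths-sym b a) ⟩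
    suc (a + b) * paths a b   ∎
    where open ≡-Reasoning

  paths-step : ∀ a b → paths a b ≤ paths a (suc b)
  paths-step zero    b = ≤-refl
  paths-step (suc a) b = m≤n+m (paths (suc a) b) (paths a (suc b))

  paths-monoʳ : ∀ a {b c} → b ≤ c → paths a b ≤ paths a c
  paths-monoʳ a b≤c = mono (≤⇒≤′ b≤c)
    where
    mono : ∀ {b c} → b ≤′ c → paths a b ≤ paths a c
    mono ≤′-refl       = ≤-refl
    mono (≤′-step b≤c) = ≤-trans (mono b≤c) (paths-step a _)

  -- Once b is at least about a/2, increasing b by one at most triples the
  -- coefficient, since the ratio is (a+b+1)/(b+1).
  paths-ratio : ∀ a b → a ≤ 2 * b + 2 → paths a (suc b) ≤ 3 * paths a b
  paths-ratio a b a≤ = *-cancelˡ-≤ (suc b) (begin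
    suc b * paths a (suc b)   ≡⟨ paths-absorptionʳ a b ⟩
    suc (a + b) * paths a b   ≤⟨ *-monoˡ-≤ (paths a b) factor ⟩
    (suc b * 3) * paths a b   ≡⟨ *-assoc (suc b) 3 (paths a b) ⟩
    suc b * (3 * paths a b)   ∎)
    where
    open ≤-Reasoning
    three : ∀ b → suc (2 * b + 2 + b) ≡ suc b * 3
    three = solve-∀
    factor : suc (a + b) ≤ suc b * 3
    factor = subst (suc (a + b) ≤_) (three b) (s≤s (+-monoˡ-≤ b a≤))

  paths-ratio-iterated : ∀ i a b → a ≤ 2 * b + 2 → paths a (i + b) ≤ 3 ^ i * paths a b
  paths-ratio-iterated zero    a b a≤ = ≤-reflexive (sym (+-identityʳ (paths a b)))
  paths-ratio-iterated (suc i) a b a≤ = begin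
    paths a (suc (i + b))   ≤⟨ paths-ratio a (i + b) (≤-trans a≤ (+-monoˡ-≤ 2 (*-monoʳ-≤ 2 (m≤n+m b i)))) ⟩
    3 * paths a (i + b)     ≤⟨ *-monoʳ-≤ 3 (paths-ratio-iterated i a b a≤) ⟩
    3 * (3 ^ i * paths a b) ≡⟨ sym (*-assoc 3 (3 ^ i) (paths a b)) ⟩
    3 ^ suc i * paths a b   ∎
    where open ≤-Reasoning

  -- ballot t h counts the admissible codes of the discovery process below:
  -- t houses are still to be discovered and h discovered houses are not yet
  -- accounted for by a processed buyer.  ballot m 0 is the Catalan number.
  ballot : ℕ → ℕ → ℕ
  ballot zero    zero    = 1
  ballot zero    (suc h) = ballot zero h
  ballot (suc t) zero    = ballot t 1
  ballot (suc t) (suc h) = ballot (suc t) h + ballot t (suc (suc h))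

  ballot-zero : ∀ h → ballot zero h ≡ 1
  ballot-zero zero    = refl
  ballot-zero (suc h) = ballot-zero h

  -- The reflection principle: ballot numbers are differences of binomial
  -- coefficients, ballot (t+1) h = C(2t+h+2, t+1) − C(2t+h+2, t).
  ballot-reflection : ∀ t h → ballot (suc t) h + paths t (suc (suc (h + t))) ≡ paths (suc t) (suc (h + t))
  ballot-reflection zero    zero    = refl
  ballot-reflection zero    (suc h) = begin
    (ballot 1 h + ballot zero (suc (suc h))) + 1 ≡⟨ cong (λ z → (ballot 1 h + z) + 1) (ballot-zero (suc (suc h))) ⟩
    (ballot 1 h + 1) + 1                        ≡⟨ cong (_+ 1) (ballot-reflection zero h) ⟩
    paths 1 (suc (h + 0)) + 1                   ≡⟨ +-comm (paths 1 (suc (h + 0))) 1 ⟩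
    1 + paths 1 (suc (h + 0))                   ∎
    where open ≡-Reasoning
  ballot-reflection (suc t) zero    = begin
    B + (paths t (suc (suc (suc t))) + P)       ≡⟨ sym (+-assoc B _ P) ⟩
    (B + paths t (suc (suc (suc t)))) + P       ≡⟨ cong (_+ P) (ballot-reflection t 1) ⟩
    P + P                                       ≡⟨ cong (P +_) (paths-sym (suc t) (suc (suc t))) ⟩
    P + paths (suc (suc t)) (suc t)             ∎
    where
    open ≡-Reasoning
    B = ballot (suc t) 1
    P = paths (suc t) (suc (suc t))
  ballot-reflection (suc t) (suc h) = begin
    (A + B) + (X + Y)               ≡⟨ interchange A B X Y ⟩
    (A + Y) + (B + X)               ≡⟨ cong₂ _+_ (ballot-reflection (suc t) h) reflection′ ⟩
    paths (suc (suc t)) K + Y       ≡⟨ +-comm (paths (suc (suc t)) K) Y ⟩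
    Y + paths (suc (suc t)) K       ∎
    where
    open ≡-Reasoning
    K = suc (h + suc t)
    A = ballot (suc (suc t)) h
    B = ballot (suc t) (suc (suc h))
    X = paths t (suc (suc K))
    Y = paths (suc t) (suc K)
    interchange : ∀ a b x y → (a + b) + (x + y) ≡ (a + y) + (b + x)
    interchange = solve-∀
    reflection′ : B + X ≡ Y
    reflection′ = subst (λ k → B + paths t (suc (suc k)) ≡ paths (suc t) (suc k))
                        (cong suc (sym (+-suc h t))) (ballot-reflection t (suc (suc h)))

  catalan : ∀ m → suc m * ballot m 0 ≡ paths m m
  catalan zero    = refl
  catalan (suc s) = +-cancelʳ-≡ _ _ _ (begin
    suc m * ballot m 0 + m * T       ≡⟨ cong (suc m * ballot m 0 +_) (sym reflected) ⟩
    suc m * ballot m 0 + suc m * A   ≡⟨ sym (*-distribˡ-+ (suc m) (ballot m 0) A) ⟩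
    suc m * (ballot m 0 + A)         ≡⟨ cong (suc m *_) (ballot-reflection s 0) ⟩
    suc m * T                        ∎)
    where
    open ≡-Reasoning
    m = suc s
    T = paths m m
    A = paths s (suc m)
    reflected : suc m * A ≡ m * T
    reflected = trans (paths-absorptionʳ s m) (sym (paths-absorptionˡ s m))

  double-≤ : ∀ j {m} → 2 * j ≤ m → j ≤ m
  double-≤ j 2j≤m = ≤-trans (m≤m+n j (j + 0)) 2j≤m

  half : ∀ {j m} → 2 * j ≤ m → j ≤ m ∸ j
  half {j} 2j≤m = m+n≤o⇒m≤o∸n j (≤-trans (≤-reflexive (cong (j +_) (sym (+-identityʳ j)))) 2j≤m)

  -- Removing j ≤ log₃(m+1) (and j ≤ m/2) from the second index costs at most
  -- the factor m+1 of the Catalan identity.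
  catalan-bound : ∀ m j → 3 ^ j ≤ suc m → 2 * j ≤ m → ballot m 0 ≤ paths m (m ∸ j)
  catalan-bound m j 3ʲ≤ 2j≤m = *-cancelˡ-≤ (suc m) (begin
    suc m * ballot m 0          ≡⟨ catalan m ⟩
    paths m m                   ≡⟨ cong (paths m) (sym split) ⟩
    paths m (j + (m ∸ j))       ≤⟨ paths-ratio-iterated j m (m ∸ j) ratio-applies ⟩
    3 ^ j * paths m (m ∸ j)     ≤⟨ *-monoˡ-≤ (paths m (m ∸ j)) 3ʲ≤ ⟩
    suc m * paths m (m ∸ j)     ∎)
    where
    open ≤-Reasoning
    split : j + (m ∸ j) ≡ m
    split = m+[n∸m]≡n (double-≤ j 2j≤m)
    ratio-applies : m ≤ 2 * (m ∸ j) + 2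
    ratio-applies = begin
      m                             ≡⟨ sym split ⟩
      j + (m ∸ j)                   ≤⟨ +-monoˡ-≤ (m ∸ j) (half 2j≤m) ⟩
      (m ∸ j) + (m ∸ j)             ≡⟨ cong ((m ∸ j) +_) (sym (+-identityʳ (m ∸ j))) ⟩
      2 * (m ∸ j)                   ≤⟨ m≤m+n (2 * (m ∸ j)) 2 ⟩
      2 * (m ∸ j) + 2               ∎

  -- The elementary estimates that turn ℓ^ℓ ≤ m into the hypotheses of
  -- catalan-bound for j = ℓ − 4.
  two-pow : ∀ j → 2 * j ≤ 3 ^ j
  two-pow zero    = z≤n
  two-pow (suc j) = begin
    2 * suc j         ≡⟨ *-suc 2 j ⟩
    2 + 2 * j         ≤⟨ +-monoʳ-≤ 2 (two-pow j) ⟩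
    2 + 3 ^ j         ≤⟨ +-monoˡ-≤ (3 ^ j) (*-monoʳ-≤ 2 (m^n>0 3 j)) ⟩
    2 * 3 ^ j + 3 ^ j ≡⟨ +-comm (2 * 3 ^ j) (3 ^ j) ⟩
    3 * 3 ^ j         ∎
    where open ≤-Reasoning

  three-pow : ∀ ℓ → 3 ^ (ℓ ∸ 4) ≤ ℓ ^ ℓ
  three-pow 0 = s≤s z≤n
  three-pow 1 = s≤s z≤n
  three-pow 2 = s≤s z≤n
  three-pow 3 = s≤s z≤n
  three-pow 4 = s≤s z≤n
  three-pow ℓ@(suc (suc (suc (suc (suc i))))) = begin
    3 ^ suc i  ≤⟨ ^-monoˡ-≤ (suc i) (s≤s (s≤s (s≤s z≤n))) ⟩
    ℓ ^ suc i  ≤⟨ ^-monoʳ-≤ ℓ (m≤n+m (suc i) 4) ⟩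
    ℓ ^ ℓ      ∎
    where open ≤-Reasoning

  monus-monus : ∀ a b c → a ∸ (b ∸ c) ≤ (a ∸ b) + c
  monus-monus a b c = m≤n+o⇒m∸n≤o a (b ∸ c) (begin
    a                               ≤⟨ m≤n+m∸n a b ⟩
    b + (a ∸ b)                     ≤⟨ +-monoˡ-≤ (a ∸ b) (m≤n+m∸n b c) ⟩
    (c + (b ∸ c)) + (a ∸ b)         ≡⟨ rearrange c (b ∸ c) (a ∸ b) ⟩
    (b ∸ c) + ((a ∸ b) + c)         ∎)
    where
    open ≤-Reasoning
    rearrange : ∀ x y z → (x + y) + z ≡ y + (z + x)
    rearrange = solve-∀

  ballot-bound : ∀ m ℓ → ℓ ^ ℓ ≤ m → ballot m 0 ≤ (2 * m ∸ ℓ + 4) C m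
  ballot-bound m ℓ ℓˡ≤m = begin
    ballot m 0           ≤⟨ catalan-bound m j (≤-trans 3ʲ≤m (n≤1+n m)) 2j≤m ⟩
    paths m (m ∸ j)      ≤⟨ paths-monoʳ m (m+n≤o⇒m≤o∸n (m ∸ j) slack) ⟩
    paths m (n ∸ m)      ≡⟨ paths≡binomial m (n ∸ m) ⟩
    (m + (n ∸ m)) C m    ≡⟨ cong (_C m) (m+[n∸m]≡n m≤n) ⟩
    n C m                ∎
    where
    open ≤-Reasoning
    j = ℓ ∸ 4
    n = 2 * m ∸ ℓ + 4
    3ʲ≤m : 3 ^ j ≤ m
    3ʲ≤m = ≤-trans (three-pow ℓ) ℓˡ≤m
    2j≤m : 2 * j ≤ m
    2j≤m = ≤-trans (two-pow j) 3ʲ≤m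
    slack : (m ∸ j) + m ≤ n
    slack = begin
      (m ∸ j) + m          ≡⟨ sym (+-∸-comm m (double-≤ j 2j≤m)) ⟩
      (m + m) ∸ j          ≡⟨ cong (λ x → (m + x) ∸ j) (sym (+-identityʳ m)) ⟩
      2 * m ∸ j            ≤⟨ monus-monus (2 * m) ℓ 4 ⟩
      n                    ∎
    m≤n : m ≤ n
    m≤n = ≤-trans (m≤n+m m (m ∸ j)) slack


-- Admissible codes and their enumeration.
module Codes where

  open import Data.Nat
  open import Data.Nat.Properties
  open import Data.List using (List; []; _∷_; map; _++_; length; [_])
  open import Data.List.Properties using (length-++; length-map)
  open import Data.List.Membership.Propositional using (_∈_)
  open import Data.List.Membership.Propositional.Properties using (∈-map⁺; ∈-++⁺ˡ; ∈-++⁺ʳ)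
  open import Data.List.Relation.Unary.Any using (here)
  open import Data.Product using (_×_; _,_)
  open import Relation.Binary.PropositionalEquality hiding ([_])
  open BallotNumbers using (ballot)

  -- A code c₁ c₂ … records how many new houses each buyer discovers.  In
  -- state (t, h) there are t houses still undiscovered and h discovered
  -- houses not yet accounted for by a processed buyer.  A buyer discovers at
  -- most t houses, after which one pending house must be left for it; at the
  -- end nothing is pending or undiscovered.
  Admissible : ℕ → ℕ → List ℕ → Set
  Admissible t h []       = t ≡ 0 × h ≡ 0
  Admissible t h (c ∷ cs) = c ≤ t × 1 ≤ h + c × Admissible (t ∸ c) (h + c ∸ 1) cs

  -- codes t h c lists the admissible completions in state (h, t) when the
  -- current buyer has already discovered c houses (counted in h, not in t):
  -- either the buyer stops, or it discovers one more house.
  codes : ℕ → ℕ → ℕ → List (List ℕ)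
  codes zero    zero    c = [ [] ]
  codes zero    (suc h) c = map (c ∷_) (codes zero h 0)
  codes (suc t) zero    c = codes t 1 (suc c)
  codes (suc t) (suc h) c = map (c ∷_) (codes (suc t) h 0) ++ codes t (suc (suc h)) (suc c)

  codes-length : ∀ t h c → length (codes t h c) ≡ ballot t h
  codes-length zero    zero    c = refl
  codes-length zero    (suc h) c = trans (length-map (c ∷_) (codes zero h 0)) (codes-length zero h 0)
  codes-length (suc t) zero    c = codes-length t 1 (suc c)
  codes-length (suc t) (suc h) c = begin
    length (map (c ∷_) stop ++ codes t (suc (suc h)) (suc c))     ≡⟨ length-++ (map (c ∷_) stop) ⟩
    length (map (c ∷_) stop) + length (codes t (suc (suc h)) (suc c)) ≡⟨ cong₂ _+_ (length-map (c ∷_) stop) (codes-length t (suc (suc h)) (suc c)) ⟩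
    length stop + ballot t (suc (suc h))                          ≡⟨ cong (_+ ballot t (suc (suc h))) (codes-length (suc t) h 0) ⟩
    ballot (suc t) h + ballot t (suc (suc h))                     ∎
    where
    open ≡-Reasoning
    stop = codes (suc t) h 0

  codes-extend : ∀ e t h c cs → e ≤ t → 1 ≤ h + e → cs ∈ codes (t ∸ e) (h + e ∸ 1) 0 → (c + e) ∷ cs ∈ codes t h c
  codes-extend zero    zero    (suc h) c cs _ _ cs∈ rewrite +-identityʳ c | +-identityʳ h = ∈-map⁺ (c ∷_) cs∈
  codes-extend zero    (suc t) (suc h) c cs _ _ cs∈ rewrite +-identityʳ c | +-identityʳ h = ∈-++⁺ˡ (∈-map⁺ (c ∷_) cs∈)
  codes-extend (suc e) (suc t) zero    c cs (s≤s e≤t) _ cs∈ rewrite +-suc c e =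
    codes-extend e t 1 (suc c) cs e≤t (s≤s z≤n) cs∈
  codes-extend (suc e) (suc t) (suc h) c cs (s≤s e≤t) _ cs∈ rewrite +-suc c e =
    ∈-++⁺ʳ (map (c ∷_) (codes (suc t) h 0))
           (codes-extend e t (suc (suc h)) (suc c) cs e≤t (s≤s z≤n) (subst (λ k → cs ∈ codes (t ∸ e) k 0) (+-suc h e) cs∈))

  codes-complete : ∀ t h cs → Admissible t h cs → cs ∈ codes t h 0
  codes-complete t h []       (refl , refl)     = here refl
  codes-complete t h (c ∷ cs) (c≤t , 1≤ , rest) = codes-extend c t h 0 cs c≤t 1≤ (codes-complete _ _ cs rest)

  -- The invariant behind admissibility: if before a buyer u houses are
  -- discovered, d buyers processed (d ≤ u), and afterwards u + c ≤ M houses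
  -- are discovered and cover the d + 1 processed buyers, the entry c is legal.
  admissible-cons : ∀ {u c d M cs} → d ≤ u → suc d ≤ u + c → u + c ≤ M →
                    Admissible (M ∸ (u + c)) (u + c ∸ suc d) cs → Admissible (M ∸ u) (u ∸ d) (c ∷ cs)
  admissible-cons {u} {c} {d} {M} {cs} d≤u d<u+c u+c≤M rest =
    m+n≤o⇒m≤o∸n c (subst (_≤ M) (+-comm u c) u+c≤M) ,
    subst (1 ≤_) (sym shift) (m+n≤o⇒m≤o∸n 1 d<u+c) ,
    subst₂ (λ t h → Admissible t h cs) (sym (∸-+-assoc M u c)) (sym pending) rest
    where
    shift : (u ∸ d) + c ≡ (u + c) ∸ d
    shift = sym (+-∸-comm c d≤u)
    pending : (u ∸ d) + c ∸ 1 ≡ (u + c) ∸ suc d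
    pending = trans (cong (_∸ 1) shift) (trans (∸-+-assoc (u + c) d 1) (cong ((u + c) ∸_) (+-comm d 1)))


module Lists where

  open import Data.Nat using (ℕ; zero; suc; _+_; _≤_; _<_; _≤′_; ≤′-refl; ≤′-step; s≤s; _≟_)
  open import Data.Nat.Properties
  open import Data.Fin as Fin using (Fin)
  open import Data.Fin.Properties using (injective⇒≤)
  open import Data.List using (List; []; _∷_; _++_; length; [_]; filter; lookup)
  open import Data.List.Properties using (length-++; filter-++; ++-identityʳ; ++-assoc)
  open import Data.List.Membership.Propositional using (_∈_; _∉_)
  open import Data.List.Membership.Propositional.Properties using (∈-++⁺ˡ; ∈-++⁺ʳ; ∈-++⁻; ∈-lookup; ∈-filter⁺; ∈-filter⁻)
  open import Data.List.Membership.DecPropositional _≟_ using (_∈?_)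
  open import Data.List.Membership.Setoid.Properties using (index-injective)
  open import Data.List.Relation.Unary.Any using (here; index)
  import Data.List.Relation.Unary.All as All
  import Data.List.Relation.Unary.All.Properties as AllProps
  open import Data.List.Relation.Unary.AllPairs using ([]; _∷_)
  open import Data.List.Relation.Unary.Unique.Propositional using (Unique)
  import Data.List.Relation.Unary.Unique.Propositional.Properties as Unique
  open import Data.Product using (∃; _×_; _,_)
  open import Data.Sum using (inj₁; inj₂)
  open import Data.Empty using (⊥-elim)
  open import Relation.Nullary using (¬_; ¬?)
  open import Relation.Unary using (Decidable)
  open import Relation.Binary.PropositionalEquality hiding ([_])

  lookup-injective : ∀ {A : Set} {xs : List A} → Unique xs → ∀ {i j} → lookup xs i ≡ lookup xs j → i ≡ j
  lookup-injective {xs = x ∷ xs} (x∉ ∷ u) {Fin.zero}  {Fin.zero}  eq = refl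
  lookup-injective {xs = x ∷ xs} (x∉ ∷ u) {Fin.zero}  {Fin.suc j} eq = ⊥-elim (All.lookup x∉ (∈-lookup j) eq)
  lookup-injective {xs = x ∷ xs} (x∉ ∷ u) {Fin.suc i} {Fin.zero}  eq = ⊥-elim (All.lookup x∉ (∈-lookup i) (sym eq))
  lookup-injective {xs = x ∷ xs} (x∉ ∷ u) {Fin.suc i} {Fin.suc j} eq = cong Fin.suc (lookup-injective u eq)

  unique-length-≤ : ∀ {A B : Set} (g : A → B) → (∀ {x y} → g x ≡ g y → x ≡ y) →
                    ∀ {xs : List A} {ys : List B} → Unique xs → (∀ {x} → x ∈ xs → g x ∈ ys) →
                    length xs ≤ length ys
  unique-length-≤ g g-inj {xs} {ys} u into = injective⇒≤ {f = position} position-injective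
    where
    position : Fin (length xs) → Fin (length ys)
    position i = index (into (∈-lookup i))
    position-injective : ∀ {i j} → position i ≡ position j → i ≡ j
    position-injective {i} {j} eq =
      lookup-injective u (g-inj (index-injective (setoid _) (into (∈-lookup i)) (into (∈-lookup j)) eq))

  prefix : (ℕ → ℕ) → ℕ → List ℕ
  prefix f zero    = []
  prefix f (suc n) = prefix f n ++ [ f n ]

  prefix⁻ : ∀ f n {x} → x ∈ prefix f n → ∃ λ q → q < n × f q ≡ x
  prefix⁻ f (suc n) x∈ with ∈-++⁻ (prefix f n) x∈
  ... | inj₁ x∈′ = let (q , q<n , eq) = prefix⁻ f n x∈′ in q , m<n⇒m<1+n q<n , eq
  ... | inj₂ (here eq) = n , ≤-refl , sym eq

  prefix⁺ : ∀ f n q → q < n → f q ∈ prefix f n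
  prefix⁺ f (suc n) q (s≤s q≤n) with m≤n⇒m<n∨m≡n q≤n
  ... | inj₁ q<n  = ∈-++⁺ˡ (prefix⁺ f n q q<n)
  ... | inj₂ refl = ∈-++⁺ʳ (prefix f q) (here refl)

  prefix-unique : ∀ f → (∀ {p q} → f p ≡ f q → p ≡ q) → ∀ n → Unique (prefix f n)
  prefix-unique f f-inj zero    = []
  prefix-unique f f-inj (suc n) = Unique.++⁺ (prefix-unique f f-inj n) (All.[] ∷ []) disjoint
    where
    disjoint : ∀ {v} → ¬ (v ∈ prefix f n × v ∈ [ f n ])
    disjoint (v∈ , here refl) = let (q , q<n , eq) = prefix⁻ f n v∈ in <-irrefl (f-inj eq) q<n

  unique-++ˡ : ∀ {A : Set} (xs : List A) {ys} → Unique (xs ++ ys) → Unique xs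
  unique-++ˡ []       _          = []
  unique-++ˡ (x ∷ xs) (x∉ ∷ u) = AllProps.++⁻ˡ xs x∉ ∷ unique-++ˡ xs u

  outside? : (U : List ℕ) → Decidable (_∉ U)
  outside? U x = ¬? (x ∈? U)

  fresh : List ℕ → (ℕ → ℕ) → ℕ → List ℕ
  fresh U f n = filter (outside? U) (prefix f n)

  fresh⁻ : ∀ U f n {x} → x ∈ fresh U f n → x ∈ prefix f n × x ∉ U
  fresh⁻ U f n = ∈-filter⁻ (outside? U)

  fresh⁺ : ∀ U f n {x} → x ∈ prefix f n → x ∉ U → x ∈ fresh U f n
  fresh⁺ U f n = ∈-filter⁺ (outside? U)

  fresh-unique : ∀ U f → (∀ {p q} → f p ≡ f q → p ≡ q) → ∀ n → Unique (fresh U f n)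
  fresh-unique U f f-inj n = Unique.filter⁺ (outside? U) (prefix-unique f f-inj n)

  fresh-extends : ∀ U f {p q} → p ≤ q → ∃ λ rest → fresh U f q ≡ fresh U f p ++ rest
  fresh-extends U f p≤q = extends (≤⇒≤′ p≤q)
    where
    extends : ∀ {p q} → p ≤′ q → ∃ λ rest → fresh U f q ≡ fresh U f p ++ rest
    extends {p} ≤′-refl = [] , sym (++-identityʳ (fresh U f p))
    extends {p} (≤′-step {q} p≤q) =
      let (rest , eq) = extends p≤q
          new = filter (outside? U) [ f q ]
      in rest ++ new , (begin
        fresh U f (suc q)              ≡⟨ filter-++ (outside? U) (prefix f q) [ f q ] ⟩
        fresh U f q ++ new             ≡⟨ cong (_++ new) eq ⟩
        (fresh U f p ++ rest) ++ new   ≡⟨ ++-assoc (fresh U f p) rest new ⟩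
        fresh U f p ++ (rest ++ new)   ∎)
      where open ≡-Reasoning

  same-length-extension : ∀ {A : Set} {xs ys : List A} rest → ys ≡ xs ++ rest → length ys ≡ length xs → ys ≡ xs
  same-length-extension {xs = xs} []       eq _   = trans eq (++-identityʳ xs)
  same-length-extension {xs = xs} (r ∷ rs) eq len =
    ⊥-elim (m+1+n≢m (length xs) (trans (sym (length-++ xs)) (trans (cong length (sym eq)) len)))

  fresh-determined : ∀ U f p q → length (fresh U f p) ≡ length (fresh U f q) → fresh U f p ≡ fresh U f q
  fresh-determined U f p q len with ≤-total p q
  ... | inj₁ p≤q = let (rest , eq) = fresh-extends U f p≤q in sym (same-length-extension rest eq (sym len))
  ... | inj₂ q≤p = let (rest , eq) = fresh-extends U f q≤p in same-length-extension rest eq len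


-- The discovery process of a profile.  Buyers are processed in turn; a
-- buyer whose house sits at position p of its list discovers the houses among
-- its first p + 1 choices that were not discovered before.
module Discovery {m : ℕ} (P : PrefProfile m) where

  open import Data.Nat using (suc)
  open import Data.List using (List; []; _∷_; _++_; length)
  open import Data.List.Properties using (∷-injective)
  open import Data.Product using (proj₁; proj₂)
  open import Relation.Binary.PropositionalEquality using (_≡_; refl; cong; trans; sym)
  open Lists using (fresh; fresh-determined)

  -- pos a is the position in a's list down to which buyer a looks.
  step : (Fin m → ℕ) → List House → Fin m → List House
  step pos U a = U ++ fresh U (P a) (suc (pos a))

  run : (Fin m → ℕ) → List House → List (Fin m) → List House
  run pos U []       = U
  run pos U (a ∷ bs) = run pos (step pos U a) bs

  code : (Fin m → ℕ) → List House → List (Fin m) → List ℕ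
  code pos U []       = []
  code pos U (a ∷ bs) = length (fresh U (P a) (suc (pos a))) ∷ code pos (step pos U a) bs

  -- The code determines the discovered houses: at each step the fresh
  -- houses are determined by their number.
  run-determined : ∀ pos pos′ U bs → code pos U bs ≡ code pos′ U bs → run pos U bs ≡ run pos′ U bs
  run-determined pos pos′ U []       _  = refl
  run-determined pos pos′ U (a ∷ bs) eq =
    trans (run-determined pos pos′ (step pos U a) bs (trans (proj₂ (∷-injective eq)) (cong (λ V → code pos′ V bs) (sym same-step))))
          (cong (λ V → run pos′ V bs) same-step)
    where
    same-step : step pos U a ≡ step pos′ U a
    same-step = cong (U ++_) (fresh-determined U (P a) (suc (pos a)) (suc (pos′ a)) (proj₁ (∷-injective eq)))

  module Pareto (valid : ValidProfile P) (τ : Fin m → House) (pom : IsPOM P τ) where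

    open import Data.Nat using (_≤_; _<_; s≤s)
    open import Data.Nat.Properties using (≤-refl; m≤n⇒m<n∨m≡n; m≤n⇒m∸n≡0; ≤-trans; ≤-reflexive; +-comm)
    open import Data.Fin as Fin using ()
    open import Data.Fin.Properties using (any?)
    import Data.Fin.Subset as Subset
    open import Data.Fin.Subset.Properties using (x∈⁅x⁆; x∈⁅y⁆⇒x≡y)
    open import Data.List using ([_]; map; allFin)
    open import Data.List.Properties using (length-++; length-map; length-tabulate; ++-assoc; ++-identityʳ)
    open import Data.List.Membership.Propositional using (_∈_)
    open import Data.List.Membership.Propositional.Properties using (∈-map⁺; ∈-++⁺ˡ; ∈-++⁺ʳ; ∈-++⁻; ∈-allFin)
    open import Data.List.Membership.DecPropositional Data.Nat._≟_ using (_∈?_)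
    open import Data.List.Relation.Unary.Any using (here)
    open import Data.List.Relation.Unary.All as All using (All)
    import Data.List.Relation.Unary.AllPairs as AllPairs
    import Data.List.Relation.Unary.All.Properties as AllProps
    open import Data.List.Relation.Unary.Unique.Propositional using (Unique)
    import Data.List.Relation.Unary.Unique.Propositional.Properties as Unique
    open import Data.Product using (∃; _×_; _,_)
    open import Data.Sum using (inj₁; inj₂)
    open import Data.Empty using (⊥-elim)
    open import Relation.Nullary using (¬_; yes; no)
    open import Relation.Binary.PropositionalEquality using (subst; subst₂)
    open import Function.Bundles using (_⇔_; mk⇔)
    open Lists
    open Codes using (Admissible; admissible-cons)

    pos : Fin m → ℕ
    pos a = proj₁ (proj₂ (valid a) (τ a))

    pos-correct : ∀ a → P a (pos a) ≡ τ a
    pos-correct a = proj₂ (proj₂ (valid a) (τ a))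

    τ-injective : ∀ {a b} → τ a ≡ τ b → a ≡ b
    τ-injective = proj₁ pom

    module Switch (a : Fin m) (h : House) (unsold : ¬ Sold τ h) where

      switched : Fin m → House
      switched x with x Fin.≟ a
      ... | yes _ = h
      ... | no _  = τ x

      switched-self : switched a ≡ h
      switched-self with a Fin.≟ a
      ... | yes _  = refl
      ... | no a≢a = ⊥-elim (a≢a refl)

      switched-other : ∀ x → ¬ x ≡ a → switched x ≡ τ x
      switched-other x x≢a with x Fin.≟ a
      ... | yes x≡a = ⊥-elim (x≢a x≡a)
      ... | no _    = refl

      switched-injective : ∀ {x y} → switched x ≡ switched y → x ≡ y
      switched-injective {x} {y} eq with x Fin.≟ a | y Fin.≟ a
      ... | yes x≡a | yes y≡a = trans x≡a (sym y≡a)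
      ... | yes _   | no _    = ⊥-elim (unsold (y , sym eq))
      ... | no _    | yes _   = ⊥-elim (unsold (x , eq))
      ... | no _    | no _    = τ-injective eq

    -- Pareto optimality forces every house a buyer prefers to its own to be
    -- sold: otherwise that buyer alone could switch to it.
    preferred-sold : ∀ a q → q < pos a → Sold τ (P a q)
    preferred-sold a q q<pos with any? (λ b → τ b Data.Nat.≟ P a q)
    ... | yes sold  = sold
    ... | no unsold = ⊥-elim (proj₂ pom (Subset.⁅ a ⁆ , switched , (a , x∈⁅x⁆ a) , switched-injective , others , improves))
      where
      open Switch a (P a q) unsold
      others : ∀ x → x Subset.∉ Subset.⁅ a ⁆ → switched x ≡ τ x
      others x x∉ = switched-other x (λ x≡a → x∉ (subst (Subset._∈ Subset.⁅ a ⁆) (sym x≡a) (x∈⁅x⁆ a)))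
      improves : ∀ x → x Subset.∈ Subset.⁅ a ⁆ → PlacedHigher (P x) (switched x) (τ x)
      improves x x∈ = subst (λ y → PlacedHigher (P y) (switched y) (τ y)) (sym (x∈⁅y⁆⇒x≡y a x∈))
                            (q , pos a , sym switched-self , pos-correct a , q<pos)

    looked-at-sold : ∀ a {x} → x ∈ prefix (P a) (suc (pos a)) → Sold τ x
    looked-at-sold a x∈ with prefix⁻ (P a) (suc (pos a)) x∈
    ... | q , s≤s q≤pos , eq with m≤n⇒m<n∨m≡n q≤pos
    ...   | inj₁ q<pos = subst (Sold τ) eq (preferred-sold a q q<pos)
    ...   | inj₂ refl  = a , trans (sym (pos-correct a)) eq

    own-discovered : ∀ U a → τ a ∈ step pos U a
    own-discovered U a with τ a ∈? U
    ... | yes τa∈U = ∈-++⁺ˡ τa∈U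
    ... | no τa∉U  = ∈-++⁺ʳ U (fresh⁺ U (P a) (suc (pos a))
                       (subst (_∈ prefix (P a) (suc (pos a))) (pos-correct a) (prefix⁺ (P a) (suc (pos a)) (pos a) ≤-refl)) τa∉U)

    record Invariant (U : List House) (done bs : List (Fin m)) : Set where
      field
        distinct : Unique U
        all-sold : All (Sold τ) U
        matched  : ∀ {b} → b ∈ done → τ b ∈ U
        split    : done ++ bs ≡ allFin m

    open Invariant

    invariant-start : Invariant [] [] (allFin m)
    invariant-start = record { distinct = AllPairs.[] ; all-sold = All.[] ; matched = λ () ; split = refl }

    invariant-step : ∀ {U done a bs} → Invariant U done (a ∷ bs) → Invariant (step pos U a) (done ++ [ a ]) bs
    invariant-step {U} {done} {a} {bs} I = record
      { distinct = Unique.++⁺ (distinct I) (fresh-unique U (P a) (proj₁ (valid a)) (suc (pos a)))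
                     (λ (x∈U , x∈fresh) → proj₂ (fresh⁻ U (P a) (suc (pos a)) x∈fresh) x∈U)
      ; all-sold = AllProps.++⁺ (all-sold I) (All.tabulate (λ x∈ → looked-at-sold a (proj₁ (fresh⁻ U (P a) (suc (pos a)) x∈))))
      ; matched  = matched′
      ; split    = trans (++-assoc done [ a ] bs) (split I)
      }
      where
      matched′ : ∀ {b} → b ∈ done ++ [ a ] → τ b ∈ step pos U a
      matched′ b∈ with ∈-++⁻ done b∈
      ... | inj₁ b∈done    = ∈-++⁺ˡ (matched I b∈done)
      ... | inj₂ (here refl) = own-discovered U a

    -- At least one house per processed buyer (τ is injective), and at most
    -- m houses in total (all of them are sold).
    invariant-bounds : ∀ {U done bs} → Invariant U done bs → length done ≤ length U × length U ≤ m
    invariant-bounds {U} {done} {bs} I =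
      unique-length-≤ τ τ-injective done-distinct (matched I) ,
      ≤-trans (unique-length-≤ (λ x → x) (λ eq → eq) (distinct I) sold-image)
              (≤-reflexive (trans (length-map τ (allFin m)) (length-tabulate (λ x → x))))
      where
      done-distinct : Unique done
      done-distinct = unique-++ˡ done (subst Unique (sym (split I)) (Unique.allFin⁺ m))
      sold-image : ∀ {x} → x ∈ U → x ∈ map τ (allFin m)
      sold-image x∈ = let (a , eq) = All.lookup (all-sold I) x∈ in subst (_∈ map τ (allFin m)) eq (∈-map⁺ τ (∈-allFin a))

    -- Along the whole process the code is admissible from the current state:
    -- m − discovered houses undiscovered, discovered − processed pending.
    invariant-admissible : ∀ {U done} bs → Invariant U done bs →
                           Admissible (m ∸ length U) (length U ∸ length done) (code pos U bs)
    invariant-admissible {U} {done} [] I =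
      m≤n⇒m∸n≡0 (≤-trans (≤-reflexive (sym all-done)) done≤U) , m≤n⇒m∸n≡0 (≤-trans U≤m (≤-reflexive (sym all-done)))
      where
      done≤U = proj₁ (invariant-bounds I)
      U≤m = proj₂ (invariant-bounds I)
      all-done : length done ≡ m
      all-done = trans (cong length (trans (sym (++-identityʳ done)) (split I))) (length-tabulate (λ x → x))
    invariant-admissible {U} {done} (a ∷ bs) I =
      admissible-cons (proj₁ (invariant-bounds I))
                      (subst₂ _≤_ counted grown (proj₁ (invariant-bounds I′)))
                      (subst (_≤ m) grown (proj₂ (invariant-bounds I′)))
                      (subst₂ (λ u d → Admissible (m ∸ u) (u ∸ d) (code pos (step pos U a) bs)) grown counted
                              (invariant-admissible bs I′))
      where
      I′ = invariant-step I
      grown : length (step pos U a) ≡ length U + length (fresh U (P a) (suc (pos a)))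
      grown = length-++ U
      counted : length (done ++ [ a ]) ≡ suc (length done)
      counted = trans (length-++ done) (+-comm (length done) 1)

    invariant-run : ∀ {U done} bs → Invariant U done bs → ∃ λ done′ → Invariant (run pos U bs) done′ []
    invariant-run {done = done} [] I = done , I
    invariant-run (a ∷ bs) I = invariant-run bs (invariant-step I)

    discovered : List House
    discovered = run pos [] (allFin m)

    sold⇔discovered : ∀ h → Sold τ h ⇔ h ∈ discovered
    sold⇔discovered h = mk⇔ (λ (a , eq) → subst (_∈ discovered) eq (matched I (a∈done a))) (All.lookup (all-sold I))
      where
      done = proj₁ (invariant-run (allFin m) invariant-start)
      I = proj₂ (invariant-run (allFin m) invariant-start)
      a∈done : ∀ a → a ∈ done
      a∈done a = subst (a ∈_) (trans (sym (split I)) (++-identityʳ done)) (∈-allFin a)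

    admissible-code : Admissible m 0 (code pos [] (allFin m))
    admissible-code = invariant-admissible (allFin m) invariant-start


-- Counting reachable sets: a POM's sold set is determined by its code, and
-- every code is admissible from (m, 0), so distinct reachable sets give
-- distinct entries of the list `codes m 0 0`, of length Catalan(m).
module ReachableSets where

  open import Data.Nat.Properties using (≤-trans; ≤-reflexive)
  open import Data.Fin.Properties using (injective⇒≤)
  open import Data.List using (List; []; allFin; length)
  open import Data.List.Membership.Propositional using (_∈_)
  open import Data.List.Membership.Setoid.Properties using (index-injective)
  open import Data.List.Relation.Unary.Any using (index)
  open import Data.Product using (_,_)
  open import Relation.Binary.PropositionalEquality using (setoid; subst; sym)
  open import Function.Bundles using (Equivalence; mk⇔)
  open BallotNumbers using (ballot)
  open Codes using (codes; codes-length; codes-complete)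

  module _ {m : ℕ} {P : PrefProfile m} (valid : ValidProfile P) where

    open Discovery P

    same-code⇒same-sold : ∀ {τ τ′} (pom : IsPOM P τ) (pom′ : IsPOM P τ′) →
                          code (Pareto.pos valid τ pom) [] (allFin m) ≡ code (Pareto.pos valid τ′ pom′) [] (allFin m) →
                          SameSold τ τ′
    same-code⇒same-sold {τ} {τ′} pom pom′ eq h = mk⇔
      (λ s → from (T′.sold⇔discovered h) (subst (h ∈_) same (to (T.sold⇔discovered h) s)))
      (λ s → from (T.sold⇔discovered h) (subst (h ∈_) (sym same) (to (T′.sold⇔discovered h) s)))
      where
      module T  = Pareto valid τ pom
      module T′ = Pareto valid τ′ pom′
      open Equivalence
      same : T.discovered ≡ T′.discovered
      same = run-determined T.pos T′.pos [] (allFin m) eq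

    reachable-sets-≤-catalan : ∀ k (τs : Fin k → Fin m → House) → (∀ i → IsPOM P (τs i)) →
                               (∀ i j → SameSold (τs i) (τs j) → i ≡ j) → k ≤ ballot m 0
    reachable-sets-≤-catalan k τs poms distinct =
      ≤-trans (injective⇒≤ {f = rank} rank-injective) (≤-reflexive (codes-length m 0 0))
      where
      codeOf : Fin k → List ℕ
      codeOf i = code (Pareto.pos valid (τs i) (poms i)) [] (allFin m)
      listed : ∀ i → codeOf i ∈ codes m 0 0
      listed i = codes-complete m 0 (codeOf i) (Pareto.admissible-code valid (τs i) (poms i))
      rank : Fin k → Fin (length (codes m 0 0))
      rank i = index (listed i)
      rank-injective : ∀ {i j} → rank i ≡ rank j → i ≡ j
      rank-injective {i} {j} eq =
        distinct i j (same-code⇒same-sold (poms i) (poms j) (index-injective (setoid _) (listed i) (listed j) eq))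


-- The main theorem holds for all m (so the threshold is 0): the number of
-- reachable sets is at most Catalan(m) ≤ C(2m − ℓ + 4, m).
theorem1 : ∃ λ M → ∀ (m : ℕ) → M ≤ m → 1 ≤ m →
           ∀ (ℓ : ℕ) → ℓ ^ ℓ ≤ m → m < suc ℓ ^ suc ℓ →
           ∀ (P : PrefProfile m) → ValidProfile P →
           ∀ (k : ℕ) (τs : Fin k → Fin m → House) →
           (∀ i → IsPOM P (τs i)) →
           (∀ i j → SameSold (τs i) (τs j) → i ≡ j) →
           k ≤ (2 * m ∸ ℓ + 4) C m
theorem1 = 0 , λ m _ _ ℓ ℓˡ≤m _ P valid k τs poms distinct →
  ≤-trans (ReachableSets.reachable-sets-≤-catalan valid k τs poms distinct)
          (BallotNumbers.ballot-bound m ℓ ℓˡ≤m)
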